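{- Let $q$ be an indeterminate (or a nonzero complex number that is not a root of unity) and $a,b$ parameters. Let $f(z)$ be a formal power series and let $c_n$, $n\ge0$, be the coefficients of the expansion $$f(z)=\sum_{n\ge0}\frac{c_n}{[n]!}\,z^n\,E\bigl(([n]a+q^nb)z\bigr).$$ Then for every $n\ge1$, $$c_n=L\,D^{n-1}\Bigl(e\bigl(-([n]a+q^nb)x\bigr)f'(x)\Bigr)-q^{n-1}b\,L\,D^{n-1}\Bigl(e\Bigl(-\tfrac{[n]a+q^nb}{q}x\Bigr)f(x)\Bigr).$$
   Context: $[n]=\frac{1-q^n}{1-q}$, $[n]!=\prod_{j=1}^n[j]$. $e(z)=\sum_{k\ge0}\frac{z^k}{[k]!}$, $E(z)=\sum_{k\ge0}q^{\binom{k}{2}}\frac{z^k}{[k]!}$. $D$ is the $q$-differentiation operator in $x$ acting on formal power series: $Dg(x)=\frac{g(x)-g(qx)}{(1-q)x}$; $f'(x)=Df(x)$ (here $f$ is regarded as a series in $x$). $L$ denotes evaluation of a formal power series at $x=0$ (its constant term). -}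

module Defs where

open import Level using (Level; _⊔_)
open import Data.Nat as ℕ using (ℕ; zero; suc; _∸_)
open import Data.Nat.Combinatorics using (_C_)
open import Relation.Nullary using (¬_)
open import Algebra.Bundles using (CommutativeRing)
import Algebra.Properties.Ring as RingProps
import Relation.Binary.Reasoning.Setoid as SetoidReasoning

record Field (c ℓ : Level) : Set (Level.suc (c ⊔ ℓ)) where
  field
    commutativeRing : CommutativeRing c ℓ
  open CommutativeRing commutativeRing public
  field
    1≉0     : ¬ (1# ≈ 0#)
    inv     : (x : Carrier) → ¬ (x ≈ 0#) → Carrier
    inverse : ∀ x (x≉0 : ¬ (x ≈ 0#)) → x * inv x x≉0 ≈ 1#

module FieldNotions {c ℓ : Level} (F : Field c ℓ) where
  open Field F hiding (zero)

  infixr 8 _^′_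
  _^′_ : Carrier → ℕ → Carrier
  x ^′ zero  = 1#
  x ^′ suc n = x * x ^′ n

  natF : ℕ → Carrier
  natF zero    = 0#
  natF (suc n) = 1# + natF n

  CharZero : Set ℓ
  CharZero = ∀ n → ¬ (natF (suc n) ≈ 0#)

  NotRootOfUnity : Carrier → Set ℓ
  NotRootOfUnity q = ∀ n → ¬ (q ^′ suc n ≈ 1#)

module QCalculus {c ℓ : Level} (F : Field c ℓ) (q : Field.Carrier F)
                 (q≉0 : ¬ (Field._≈_ F q (Field.0# F)))
                 (notRoot : FieldNotions.NotRootOfUnity F q) where
  open Field F hiding (zero)
  open FieldNotions F
  open RingProps ring
  open SetoidReasoning setoid

  infixl 6 _-′_
  _-′_ : Carrier → Carrier → Carrier
  x -′ y = x + (- y)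

  -- q-numbers [n] = 1 + q + ... + q^(n-1) = (1 - q^n)/(1 - q)
  [_] : ℕ → Carrier
  [ zero ]  = 0#
  [ suc n ] = 1# + q * [ n ]

  [_]! : ℕ → Carrier
  [ zero ]!  = 1#
  [ suc n ]! = [ suc n ] * [ n ]!

  private
    key : ∀ n → (1# -′ q) * [ n ] ≈ 1# -′ q ^′ n
    key zero = begin
      (1# -′ q) * 0#   ≈⟨ zeroʳ _ ⟩
      0#               ≈⟨ sym (-‿inverseʳ 1#) ⟩
      1# -′ 1#         ∎
    key (suc n) = begin
      (1# -′ q) * (1# + q * [ n ])
        ≈⟨ distribˡ _ _ _ ⟩
      (1# -′ q) * 1# + (1# -′ q) * (q * [ n ])
        ≈⟨ +-cong (*-identityʳ _) (trans (sym (*-assoc _ _ _))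
             (trans (*-congʳ (*-comm _ _)) (*-assoc _ _ _))) ⟩
      (1# -′ q) + q * ((1# -′ q) * [ n ])
        ≈⟨ +-congˡ (*-congˡ (key n)) ⟩
      (1# -′ q) + q * (1# -′ q ^′ n)
        ≈⟨ +-congˡ (distribˡ _ _ _) ⟩
      (1# -′ q) + (q * 1# + q * (- q ^′ n))
        ≈⟨ +-congˡ (+-cong (*-identityʳ q) (sym (-‿distribʳ-* q (q ^′ n)))) ⟩
      (1# + - q) + (q + - (q * q ^′ n))
        ≈⟨ +-assoc _ _ _ ⟩
      1# + (- q + (q + - (q * q ^′ n)))
        ≈⟨ +-congˡ (sym (+-assoc _ _ _)) ⟩
      1# + ((- q + q) + - (q * q ^′ n))
        ≈⟨ +-congˡ (+-congʳ (-‿inverseˡ q)) ⟩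
      1# + (0# + - (q * q ^′ n))
        ≈⟨ +-congˡ (+-identityˡ _) ⟩
      1# -′ q ^′ suc n ∎

    diff0 : ∀ x y → x -′ y ≈ 0# → x ≈ y
    diff0 x y h = begin
      x                 ≈⟨ sym (+-identityʳ x) ⟩
      x + 0#            ≈⟨ +-congˡ (sym (-‿inverseˡ y)) ⟩
      x + (- y + y)     ≈⟨ sym (+-assoc _ _ _) ⟩
      (x -′ y) + y      ≈⟨ +-congʳ h ⟩
      0# + y            ≈⟨ +-identityˡ y ⟩
      y                 ∎

    cancel : ∀ x y (y≉0 : ¬ (y ≈ 0#)) → x * y ≈ 0# → x ≈ 0#
    cancel x y y≉0 h = begin
      x                          ≈⟨ sym (*-identityʳ x) ⟩
      x * 1#                     ≈⟨ *-congˡ (sym (inverse y y≉0)) ⟩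
      x * (y * inv y y≉0)        ≈⟨ sym (*-assoc _ _ _) ⟩
      (x * y) * inv y y≉0        ≈⟨ *-congʳ h ⟩
      0# * inv y y≉0             ≈⟨ zeroˡ _ ⟩
      0#                         ∎

  1-q≉0 : ¬ (1# -′ q ≈ 0#)
  1-q≉0 h = notRoot zero (trans (*-identityʳ q) (sym (diff0 1# q h)))

  [suc]≉0 : ∀ n → ¬ ([ suc n ] ≈ 0#)
  [suc]≉0 n h = notRoot n (sym (diff0 1# (q ^′ suc n) (begin
      1# -′ q ^′ suc n          ≈⟨ sym (key (suc n)) ⟩
      (1# -′ q) * [ suc n ]     ≈⟨ *-congˡ h ⟩
      (1# -′ q) * 0#            ≈⟨ zeroʳ _ ⟩
      0#                        ∎)))

  [_]!≉0 : ∀ n → ¬ ([ n ]! ≈ 0#)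
  [ zero ]!≉0 h  = 1≉0 h
  [ suc n ]!≉0 h = [ n ]!≉0 (cancel [ n ]! [ suc n ] ([suc]≉0 n)
                              (trans (*-comm _ _) h))

  1/[_]! : ℕ → Carrier
  1/[ n ]! = inv [ n ]! [ n ]!≉0

  q⁻¹ : Carrier
  q⁻¹ = inv q q≉0

  [1-q]⁻¹ : Carrier
  [1-q]⁻¹ = inv (1# -′ q) 1-q≉0

  Series : Set c
  Series = ℕ → Carrier

  _≋_ : Series → Series → Set ℓ
  f ≋ g = ∀ k → f k ≈ g k

  sumTo : ℕ → (ℕ → Carrier) → Carrier
  sumTo zero    h = 0#
  sumTo (suc n) h = sumTo n h + h n

  _⊕_ : Series → Series → Series
  (f ⊕ g) k = f k + g k

  ⊝_ : Series → Series
  (⊝ f) k = - f k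

  _·_ : Carrier → Series → Series
  (λ₀ · f) k = λ₀ * f k

  _⋆_ : Series → Series → Series
  (f ⋆ g) m = sumTo (suc m) (λ i → f i * g (m ∸ i))

  z^_·_ : ℕ → Series → Series
  (z^ n · f) m with ℕ._<?_ m n
  ... | Relation.Nullary.yes _ = 0#
  ... | Relation.Nullary.no  _ = f (m ∸ n)

  subst-scale : Carrier → Series → Series
  subst-scale λ₀ f k = λ₀ ^′ k * f k

  -- division by z (used only on series with zero constant term)
  divZ : Series → Series
  divZ f k = f (suc k)

  -- sum of a family of series F n in which F n has order ≥ n
  -- (locally finite sum): coefficient of z^m is Σ_{n ≤ m} (F n) m
  sumSeries : (ℕ → Series) → Series
  sumSeries Fam m = sumTo (suc m) (λ n → Fam n m)

  e : Series
  e k = 1/[ k ]!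

  E : Series
  E k = q ^′ (k C 2) * 1/[ k ]!

  -- q-derivative  D g(x) = (g(x) - g(qx)) / ((1-q) x)
  D : Series → Series
  D g = divZ ([1-q]⁻¹ · (g ⊕ (⊝ subst-scale q g)))

  D^ : ℕ → Series → Series
  D^ zero    g = g
  D^ (suc n) g = D (D^ n g)

  L : Series → Carrier
  L g = g 0

-- Put θ = λ_{m+1}, u = -θ/q and g(x) = e(ux) f(x).  Since L D^m h = [m]! h_m and the
-- q-Leibniz rule gives e(qux) f'(x) = D g(x) - u g(x), the right-hand side equals
-- [m+1]! (g_{m+1} + (a/q) g_m).  The summand z^n E(λ_n z) of f contributes to g
-- (c_n/[n]!) z^n P(z) with P(z) = e(uz) E(λ_n z), and the same rule shows
-- [t+1] P_{t+1} = (u + λ_n q^t) P_t.  For n ≤ m and t = m - n one has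
-- u + λ_n q^t + [t+1] a/q = 0, so P_{t+1} + (a/q) P_t = 0 and these summands drop out;
-- the summand n = m+1 contributes exactly c_{m+1}/[m+1]!, and later ones nothing.
module Submission where

open import Defs
open import Level using (Level)
open import Data.Nat using (ℕ; zero; suc)
open import Relation.Nullary using (¬_; yes; no; contradiction)
import Data.Nat as ℕ
import Data.Nat.Properties as ℕP
open import Data.Nat.Combinatorics using (_C_; nC1≡n; nCk+nC[k+1]≡[n+1]C[k+1])
open import Data.Integer.Base as ℤ using (ℤ; +_; -[1+_]; sign; ∣_∣; _◃_)
import Data.Integer.Properties as ℤP
open import Data.Sign.Base as Sign using (Sign)
open import Data.Maybe.Base using (Maybe; just; nothing)
open import Data.Sum.Base using (inj₁; inj₂)
open import Data.Product.Base using (_,_)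
import Relation.Binary.PropositionalEquality as ≡
open ≡ using (_≡_; cong)
open import Algebra.Bundles using (CommutativeRing)
open import Algebra.Solver.Ring.AlmostCommutativeRing
  using (fromCommutativeRing; _-Raw-AlmostCommutative⟶_)
import Algebra.Properties.Ring as RingProperties
import Algebra.Properties.Semiring.Mult as SemiringMultiplication
import Algebra.Properties.CommutativeSemigroup as CommutativeSemigroupProperties
import Relation.Binary.Reasoning.Setoid as ≈-Reasoning

-- The integers map into every commutative ring, so the library's ring solver can run
-- with integer coefficients (which is what makes x - x normalise to 0).
module IntegerCoefficientSolver {c ℓ : Level} (R : CommutativeRing c ℓ) where
  open CommutativeRing R
  open RingProperties ring
    using (-0#≈0#; -‿involutive; -‿anti-homo-+; -‿+-comm; xyx⁻¹≈y; -1*x≈-x)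
  open SemiringMultiplication semiring using (_×_; ×-homo-+; ×1-homo-*)
  open CommutativeSemigroupProperties *-commutativeSemigroup
    using () renaming (interchange to *-interchange)
  open ≈-Reasoning setoid

  fromℤ : ℤ → Carrier
  fromℤ (+ n)    = n × 1#
  fromℤ -[1+ n ] = - (suc n × 1#)

  fromSign : Sign → Carrier
  fromSign Sign.+ = 1#
  fromSign Sign.- = - 1#

  [1+x]-[1+y]≈x-y : ∀ x y → (1# + x) - (1# + y) ≈ x - y
  [1+x]-[1+y]≈x-y x y = begin
    (1# + x) - (1# + y)      ≈⟨ +-congˡ (-‿anti-homo-+ 1# y) ⟩
    (1# + x) + (- y + - 1#)  ≈⟨ +-assoc _ _ _ ⟨
    (1# + x) + - y + - 1#    ≈⟨ +-congʳ (+-assoc _ _ _) ⟩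
    1# + (x - y) + - 1#      ≈⟨ xyx⁻¹≈y 1# (x - y) ⟩
    x - y                    ∎

  fromℤ-⊖ : ∀ m n → fromℤ (m ℤ.⊖ n) ≈ m × 1# - n × 1#
  fromℤ-⊖ m       zero    = sym (trans (+-congˡ -0#≈0#) (+-identityʳ _))
  fromℤ-⊖ zero    (suc n) = sym (+-identityˡ _)
  fromℤ-⊖ (suc m) (suc n) = begin
    fromℤ (suc m ℤ.⊖ suc n)  ≡⟨ cong fromℤ (ℤP.[1+m]⊖[1+n]≡m⊖n m n) ⟩
    fromℤ (m ℤ.⊖ n)          ≈⟨ fromℤ-⊖ m n ⟩
    m × 1# - n × 1#          ≈⟨ [1+x]-[1+y]≈x-y _ _ ⟨
    suc m × 1# - suc n × 1#  ∎

  fromℤ-+ : ∀ i j → fromℤ (i ℤ.+ j) ≈ fromℤ i + fromℤ j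
  fromℤ-+ -[1+ m ] -[1+ n ] = begin
    - (suc (suc (m ℕ.+ n)) × 1#)     ≡⟨ cong (λ k → - (k × 1#)) (ℕP.+-suc (suc m) n) ⟨
    - ((suc m ℕ.+ suc n) × 1#)       ≈⟨ -‿cong (×-homo-+ 1# (suc m) (suc n)) ⟩
    - (suc m × 1# + suc n × 1#)      ≈⟨ -‿+-comm _ _ ⟨
    - (suc m × 1#) + - (suc n × 1#)  ∎
  fromℤ-+ -[1+ m ] (+ n)    = trans (fromℤ-⊖ n (suc m)) (+-comm _ _)
  fromℤ-+ (+ m)    -[1+ n ] = fromℤ-⊖ m (suc n)
  fromℤ-+ (+ m)    (+ n)    = ×-homo-+ 1# m n

  fromℤ-neg : ∀ i → fromℤ (ℤ.- i) ≈ - fromℤ i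
  fromℤ-neg -[1+ n ]  = sym (-‿involutive _)
  fromℤ-neg (+ zero)  = sym -0#≈0#
  fromℤ-neg (+ suc n) = refl

  fromℤ-◃ : ∀ s n → fromℤ (s ◃ n) ≈ fromSign s * (n × 1#)
  fromℤ-◃ s      zero    = sym (zeroʳ _)
  fromℤ-◃ Sign.+ (suc n) = sym (*-identityˡ _)
  fromℤ-◃ Sign.- (suc n) = sym (-1*x≈-x _)

  fromℤ-sign-abs : ∀ i → fromℤ i ≈ fromSign (sign i) * (∣ i ∣ × 1#)
  fromℤ-sign-abs i = trans (reflexive (cong fromℤ (≡.sym (ℤP.◃-inverse i)))) (fromℤ-◃ (sign i) ∣ i ∣)

  fromSign-* : ∀ s t → fromSign (s Sign.* t) ≈ fromSign s * fromSign t
  fromSign-* Sign.+ t      = sym (*-identityˡ _)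
  fromSign-* Sign.- Sign.+ = sym (*-identityʳ _)
  fromSign-* Sign.- Sign.- = trans (sym (-‿involutive 1#)) (sym (-1*x≈-x (- 1#)))

  fromℤ-* : ∀ i j → fromℤ (i ℤ.* j) ≈ fromℤ i * fromℤ j
  fromℤ-* i j = begin
    fromℤ ((sign i Sign.* sign j) ◃ (∣ i ∣ ℕ.* ∣ j ∣))
      ≈⟨ fromℤ-◃ (sign i Sign.* sign j) (∣ i ∣ ℕ.* ∣ j ∣) ⟩
    fromSign (sign i Sign.* sign j) * ((∣ i ∣ ℕ.* ∣ j ∣) × 1#)
      ≈⟨ *-cong (fromSign-* (sign i) (sign j)) (×1-homo-* ∣ i ∣ ∣ j ∣) ⟩
    (fromSign (sign i) * fromSign (sign j)) * ((∣ i ∣ × 1#) * (∣ j ∣ × 1#))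
      ≈⟨ *-interchange _ _ _ _ ⟩
    (fromSign (sign i) * (∣ i ∣ × 1#)) * (fromSign (sign j) * (∣ j ∣ × 1#))
      ≈⟨ *-cong (fromℤ-sign-abs i) (fromℤ-sign-abs j) ⟨
    fromℤ i * fromℤ j
      ∎

  fromℤ-morphism : ℤ.+-*-rawRing -Raw-AlmostCommutative⟶ fromCommutativeRing R
  fromℤ-morphism = record
    { ⟦_⟧    = fromℤ
    ; +-homo = fromℤ-+
    ; *-homo = fromℤ-*
    ; -‿homo = fromℤ-neg
    ; 0-homo = refl
    ; 1-homo = +-identityʳ 1#
    }

  fromℤ-≟ : ∀ i j → Maybe (fromℤ i ≈ fromℤ j)
  fromℤ-≟ i j with i ℤP.≟ j
  ... | yes ≡.refl = just refl
  ... | no _       = nothing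

  open import Algebra.Solver.Ring ℤ.+-*-rawRing (fromCommutativeRing R) fromℤ-morphism fromℤ-≟
    public

module QSeriesProperties {c ℓ : Level} (F : Field c ℓ) (q : Field.Carrier F)
                         (q≉0 : ¬ (Field._≈_ F q (Field.0# F)))
                         (notRoot : FieldNotions.NotRootOfUnity F q) where
  open Field F hiding (zero)
  open FieldNotions F
  open QCalculus F q q≉0 notRoot
  open RingProperties ring using (xyx⁻¹≈y; [y-z]x≈yx-zx)
  open IntegerCoefficientSolver commutativeRing using (solve; _:+_; _:-_; _:*_; :-_; _:=_)
  open CommutativeSemigroupProperties +-commutativeSemigroup
    using () renaming (interchange to +-interchange)
  open CommutativeSemigroupProperties *-commutativeSemigroup
    using (x∙yz≈y∙xz; x∙yz≈yx∙z) renaming (interchange to *-interchange)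
  open ≈-Reasoning setoid

  x≈y+z⇒z≈x-y : ∀ {x y z} → x ≈ y + z → z ≈ x - y
  x≈y+z⇒z≈x-y {x} {y} {z} x≈y+z = begin
    z            ≈⟨ xyx⁻¹≈y y z ⟨
    y + z - y    ≈⟨ +-congʳ x≈y+z ⟨
    x - y        ∎

  inv-*-cancelˡ : ∀ x (x≉0 : ¬ (x ≈ 0#)) y → inv x x≉0 * (x * y) ≈ y
  inv-*-cancelˡ x x≉0 y = begin
    inv x x≉0 * (x * y)  ≈⟨ *-assoc _ _ _ ⟨
    inv x x≉0 * x * y    ≈⟨ *-congʳ (trans (*-comm _ _) (inverse x x≉0)) ⟩
    1# * y               ≈⟨ *-identityˡ y ⟩
    y                    ∎

  inverse-unique : ∀ x (x≉0 : ¬ (x ≈ 0#)) y → x * y ≈ 1# → y ≈ inv x x≉0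
  inverse-unique x x≉0 y xy≈1 = begin
    y                    ≈⟨ inv-*-cancelˡ x x≉0 y ⟨
    inv x x≉0 * (x * y)  ≈⟨ *-congˡ xy≈1 ⟩
    inv x x≉0 * 1#       ≈⟨ *-identityʳ _ ⟩
    inv x x≉0            ∎

  x≈y*[x*y⁻¹] : ∀ x y (y≉0 : ¬ (y ≈ 0#)) → x ≈ y * (x * inv y y≉0)
  x≈y*[x*y⁻¹] x y y≉0 = sym (begin
    y * (x * inv y y≉0)  ≈⟨ x∙yz≈y∙xz y x _ ⟩
    x * (y * inv y y≉0)  ≈⟨ *-congˡ (inverse y y≉0) ⟩
    x * 1#               ≈⟨ *-identityʳ x ⟩
    x                    ∎)

  y*x≈0⇒x≈0 : ∀ {x y} → ¬ (y ≈ 0#) → y * x ≈ 0# → x ≈ 0#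
  y*x≈0⇒x≈0 {x} {y} y≉0 yx≈0 = begin
    x                    ≈⟨ inv-*-cancelˡ y y≉0 x ⟨
    inv y y≉0 * (y * x)  ≈⟨ *-congˡ yx≈0 ⟩
    inv y y≉0 * 0#       ≈⟨ zeroʳ _ ⟩
    0#                   ∎

  sumTo-cong : ∀ n {h k : ℕ → Carrier} → (∀ i → i ℕ.< n → h i ≈ k i) → sumTo n h ≈ sumTo n k
  sumTo-cong zero    h≈k = refl
  sumTo-cong (suc n) h≈k =
    +-cong (sumTo-cong n λ i i<n → h≈k i (ℕP.m<n⇒m<1+n i<n)) (h≈k n (ℕP.n<1+n n))

  sumTo-zero : ∀ n {h : ℕ → Carrier} → (∀ i → i ℕ.< n → h i ≈ 0#) → sumTo n h ≈ 0#
  sumTo-zero zero    h≈0 = refl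
  sumTo-zero (suc n) h≈0 = trans
    (+-cong (sumTo-zero n λ i i<n → h≈0 i (ℕP.m<n⇒m<1+n i<n)) (h≈0 n (ℕP.n<1+n n)))
    (+-identityʳ 0#)

  sumTo-+ : ∀ n (h k : ℕ → Carrier) → sumTo n (λ i → h i + k i) ≈ sumTo n h + sumTo n k
  sumTo-+ zero    h k = sym (+-identityʳ 0#)
  sumTo-+ (suc n) h k = trans (+-congʳ (sumTo-+ n h k)) (+-interchange _ _ _ _)

  *-distribˡ-sumTo : ∀ n x (h : ℕ → Carrier) → x * sumTo n h ≈ sumTo n (λ i → x * h i)
  *-distribˡ-sumTo zero    x h = zeroʳ x
  *-distribˡ-sumTo (suc n) x h = trans (distribˡ x _ _) (+-congʳ (*-distribˡ-sumTo n x h))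

  sumTo-suc : ∀ n (h : ℕ → Carrier) → sumTo (suc n) h ≈ h 0 + sumTo n (λ i → h (suc i))
  sumTo-suc zero    h = trans (+-identityˡ _) (sym (+-identityʳ _))
  sumTo-suc (suc n) h = trans (+-congʳ (sumTo-suc n h)) (+-assoc _ _ _)

  sumTo-tail-zero : ∀ {k K} (h : ℕ → Carrier) → k ℕ.≤ K →
                    (∀ i → k ℕ.≤ i → i ℕ.< K → h i ≈ 0#) → sumTo K h ≈ sumTo k h
  sumTo-tail-zero {K = zero}  h ℕ.z≤n _ = refl
  sumTo-tail-zero {K = suc K} h k≤1+K h≈0 with ℕP.m≤n⇒m<n∨m≡n k≤1+K
  ... | inj₂ ≡.refl = refl
  ... | inj₁ k<1+K  = trans
    (+-cong (sumTo-tail-zero h k≤K λ i k≤i i<K → h≈0 i k≤i (ℕP.m<n⇒m<1+n i<K))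
            (h≈0 K k≤K (ℕP.n<1+n K)))
    (+-identityʳ _)
    where k≤K = ℕP.≤-pred k<1+K

  sumTo-comm : ∀ n k (h : ℕ → ℕ → Carrier) →
               sumTo n (λ i → sumTo k (h i)) ≈ sumTo k (λ j → sumTo n (λ i → h i j))
  sumTo-comm zero    k h = sym (sumTo-zero k λ _ _ → refl)
  sumTo-comm (suc n) k h = trans (+-congʳ (sumTo-comm n k h)) (sym (sumTo-+ k _ (h n)))

  ^′-congˡ : ∀ {x y} n → x ≈ y → x ^′ n ≈ y ^′ n
  ^′-congˡ zero    x≈y = refl
  ^′-congˡ (suc n) x≈y = *-cong x≈y (^′-congˡ n x≈y)

  ^′-homo-+ : ∀ x m n → x ^′ (m ℕ.+ n) ≈ x ^′ m * x ^′ n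
  ^′-homo-+ x zero    n = sym (*-identityˡ _)
  ^′-homo-+ x (suc m) n = trans (*-congˡ (^′-homo-+ x m n)) (sym (*-assoc _ _ _))

  ^′-distrib-* : ∀ x y n → (x * y) ^′ n ≈ x ^′ n * y ^′ n
  ^′-distrib-* x y zero    = sym (*-identityˡ 1#)
  ^′-distrib-* x y (suc n) = trans (*-congˡ (^′-distrib-* x y n)) (*-interchange x y _ _)

  [m+n]≈[m]+q^m*[n] : ∀ m n → [ m ℕ.+ n ] ≈ [ m ] + q ^′ m * [ n ]
  [m+n]≈[m]+q^m*[n] zero    n = trans (sym (*-identityˡ _)) (sym (+-identityˡ _))
  [m+n]≈[m]+q^m*[n] (suc m) n = trans (+-congˡ (*-congˡ ([m+n]≈[m]+q^m*[n] m n)))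
    (solve 5 (λ o q A Q N → o :+ q :* (A :+ Q :* N) := (o :+ q :* A) :+ (q :* Q) :* N)
           refl 1# q [ m ] (q ^′ m) [ n ])

  [1-q]*[n]≈1-q^n : ∀ n → (1# - q) * [ n ] ≈ 1# - q ^′ n
  [1-q]*[n]≈1-q^n zero    = trans (zeroʳ _) (sym (-‿inverseʳ 1#))
  [1-q]*[n]≈1-q^n (suc n) = begin
    (1# - q) * (1# + q * [ n ])
      ≈⟨ solve 3 (λ o q N → (o :- q) :* (o :+ q :* N) := (o :- q) :* o :+ q :* ((o :- q) :* N))
               refl 1# q [ n ] ⟩
    (1# - q) * 1# + q * ((1# - q) * [ n ])
      ≈⟨ +-cong (*-identityʳ _) (*-congˡ ([1-q]*[n]≈1-q^n n)) ⟩
    (1# - q) + q * (1# - q ^′ n)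
      ≈⟨ +-congˡ (trans (distribˡ _ _ _) (+-congʳ (*-identityʳ q))) ⟩
    (1# - q) + (q + q * - q ^′ n)
      ≈⟨ solve 3 (λ o q Q → (o :- q) :+ (q :+ q :* (:- Q)) := o :- q :* Q) refl 1# q (q ^′ n) ⟩
    1# - q ^′ suc n
      ∎

  [1+n]*1/[1+n]!≈1/[n]! : ∀ n → [ suc n ] * 1/[ suc n ]! ≈ 1/[ n ]!
  [1+n]*1/[1+n]!≈1/[n]! n = inverse-unique [ n ]! [ n ]!≉0 _
    (trans (x∙yz≈yx∙z [ n ]! [ suc n ] _) (inverse _ [ suc n ]!≉0))

  1/[0]!≈1 : 1/[ 0 ]! ≈ 1#
  1/[0]!≈1 = sym (inverse-unique 1# [ 0 ]!≉0 1# (*-identityˡ 1#))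

  D-coeff : ∀ h k → D h k ≈ [ suc k ] * h (suc k)
  D-coeff h k = begin
    [1-q]⁻¹ * (h (suc k) - q ^′ suc k * h (suc k))
      ≈⟨ *-congˡ (trans (+-congʳ (sym (*-identityˡ _))) (sym ([y-z]x≈yx-zx _ _ _))) ⟩
    [1-q]⁻¹ * ((1# - q ^′ suc k) * h (suc k))
      ≈⟨ *-congˡ (*-congʳ (sym ([1-q]*[n]≈1-q^n (suc k)))) ⟩
    [1-q]⁻¹ * ((1# - q) * [ suc k ] * h (suc k))
      ≈⟨ *-congˡ (*-assoc _ _ _) ⟩
    [1-q]⁻¹ * ((1# - q) * ([ suc k ] * h (suc k)))
      ≈⟨ inv-*-cancelˡ _ 1-q≉0 _ ⟩
    [ suc k ] * h (suc k)
      ∎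

  [k]!*D^-coeff : ∀ m h k → [ k ]! * D^ m h k ≈ [ m ℕ.+ k ]! * h (m ℕ.+ k)
  [k]!*D^-coeff zero    h k = refl
  [k]!*D^-coeff (suc m) h k = begin
    [ k ]! * D (D^ m h) k                  ≈⟨ *-congˡ (D-coeff (D^ m h) k) ⟩
    [ k ]! * ([ suc k ] * D^ m h (suc k))  ≈⟨ x∙yz≈yx∙z _ _ _ ⟩
    [ suc k ]! * D^ m h (suc k)            ≈⟨ [k]!*D^-coeff m h (suc k) ⟩
    [ m ℕ.+ suc k ]! * h (m ℕ.+ suc k)     ≡⟨ cong (λ j → [ j ]! * h j) (ℕP.+-suc m k) ⟩
    [ suc m ℕ.+ k ]! * h (suc m ℕ.+ k)     ∎

  L-D^ : ∀ m h → L (D^ m h) ≈ [ m ]! * h m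
  L-D^ m h = begin
    D^ m h 0                    ≈⟨ *-identityˡ _ ⟨
    [ 0 ]! * D^ m h 0           ≈⟨ [k]!*D^-coeff m h 0 ⟩
    [ m ℕ.+ 0 ]! * h (m ℕ.+ 0)  ≡⟨ cong (λ j → [ j ]! * h j) (ℕP.+-identityʳ m) ⟩
    [ m ]! * h m                ∎

  subst-scale-cong : ∀ {x y} h → x ≈ y → subst-scale x h ≋ subst-scale y h
  subst-scale-cong h x≈y k = *-congʳ (^′-congˡ k x≈y)

  subst-scale-∘ : ∀ x y h → subst-scale x (subst-scale y h) ≋ subst-scale (x * y) h
  subst-scale-∘ x y h k = trans (sym (*-assoc _ _ _)) (*-congʳ (sym (^′-distrib-* x y k)))

  ⋆-congˡ : ∀ {f f′} → f ≋ f′ → ∀ g → (f ⋆ g) ≋ (f′ ⋆ g)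
  ⋆-congˡ f≋f′ g m = sumTo-cong (suc m) λ i _ → *-congʳ (f≋f′ i)

  ⋆-congʳ : ∀ f {g g′} → g ≋ g′ → (f ⋆ g) ≋ (f ⋆ g′)
  ⋆-congʳ f g≋g′ m = sumTo-cong (suc m) λ i _ → *-congˡ (g≋g′ (m ℕ.∸ i))

  ⋆-·ˡ : ∀ x f g → ((x · f) ⋆ g) ≋ (x · (f ⋆ g))
  ⋆-·ˡ x f g m = trans (sumTo-cong (suc m) λ i _ → *-assoc _ _ _)
                       (sym (*-distribˡ-sumTo (suc m) x _))

  ⋆-·ʳ : ∀ f x g → (f ⋆ (x · g)) ≋ (x · (f ⋆ g))
  ⋆-·ʳ f x g m = trans (sumTo-cong (suc m) λ i _ → x∙yz≈y∙xz _ _ _)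
                       (sym (*-distribˡ-sumTo (suc m) x _))

  subst-scale-⋆ : ∀ x f g → subst-scale x (f ⋆ g) ≋ (subst-scale x f ⋆ subst-scale x g)
  subst-scale-⋆ x f g m = trans (*-distribˡ-sumTo (suc m) _ _)
                                (sumTo-cong (suc m) λ i i<1+m → split i (ℕP.≤-pred i<1+m))
    where
    split : ∀ i → i ℕ.≤ m → x ^′ m * (f i * g (m ℕ.∸ i))
                            ≈ x ^′ i * f i * (x ^′ (m ℕ.∸ i) * g (m ℕ.∸ i))
    split i i≤m = begin
      x ^′ m * (f i * g (m ℕ.∸ i))
        ≡⟨ cong (λ k → x ^′ k * (f i * g (m ℕ.∸ i))) (ℕP.m+[n∸m]≡n i≤m) ⟨
      x ^′ (i ℕ.+ (m ℕ.∸ i)) * (f i * g (m ℕ.∸ i))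
        ≈⟨ *-congʳ (^′-homo-+ x i (m ℕ.∸ i)) ⟩
      x ^′ i * x ^′ (m ℕ.∸ i) * (f i * g (m ℕ.∸ i))
        ≈⟨ *-interchange _ _ _ _ ⟩
      x ^′ i * f i * (x ^′ (m ℕ.∸ i) * g (m ℕ.∸ i))
        ∎

  -- Split [m+1] = [i] + q^i [m+1-i] in the i-th term of the Cauchy product.
  D-⋆ : ∀ f g → D (f ⋆ g) ≋ ((D f ⋆ g) ⊕ (subst-scale q f ⋆ D g))
  D-⋆ f g m = begin
    D (f ⋆ g) m                                           ≈⟨ D-coeff (f ⋆ g) m ⟩
    [ suc m ] * sumTo (suc (suc m)) T                     ≈⟨ *-distribˡ-sumTo (suc (suc m)) _ T ⟩
    sumTo (suc (suc m)) (λ i → [ suc m ] * T i)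
      ≈⟨ sumTo-cong (suc (suc m)) (λ i i<2+m → split i (ℕP.≤-pred i<2+m)) ⟩
    sumTo (suc (suc m)) (λ i → left i + right i)          ≈⟨ sumTo-+ (suc (suc m)) left right ⟩
    sumTo (suc (suc m)) left + sumTo (suc (suc m)) right  ≈⟨ +-cong left-sum right-sum ⟩
    (D f ⋆ g) m + (subst-scale q f ⋆ D g) m               ∎
    where
    T left right : ℕ → Carrier
    T i     = f i * g (suc m ℕ.∸ i)
    left i  = [ i ] * T i
    right i = q ^′ i * [ suc m ℕ.∸ i ] * T i

    split : ∀ i → i ℕ.≤ suc m → [ suc m ] * T i ≈ left i + right i
    split i i≤1+m = begin
      [ suc m ] * T i                             ≡⟨ cong (λ k → [ k ] * T i) (ℕP.m+[n∸m]≡n i≤1+m) ⟨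
      [ i ℕ.+ (suc m ℕ.∸ i) ] * T i               ≈⟨ *-congʳ ([m+n]≈[m]+q^m*[n] i _) ⟩
      ([ i ] + q ^′ i * [ suc m ℕ.∸ i ]) * T i    ≈⟨ distribʳ _ _ _ ⟩
      left i + right i                            ∎

    left-sum : sumTo (suc (suc m)) left ≈ (D f ⋆ g) m
    left-sum = begin
      sumTo (suc (suc m)) left                       ≈⟨ sumTo-suc (suc m) left ⟩
      0# * T 0 + sumTo (suc m) (λ i → left (suc i))
        ≈⟨ +-cong (zeroˡ _) (sumTo-cong (suc m) λ i _ →
             trans (sym (*-assoc _ _ _)) (*-congʳ (sym (D-coeff f i)))) ⟩
      0# + (D f ⋆ g) m                               ≈⟨ +-identityˡ _ ⟩
      (D f ⋆ g) m                                    ∎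

    right≈ : ∀ i → i ℕ.≤ m → right i ≈ subst-scale q f i * D g (m ℕ.∸ i)
    right≈ i i≤m = begin
      q ^′ i * [ suc m ℕ.∸ i ] * (f i * g (suc m ℕ.∸ i))
        ≡⟨ cong (λ k → q ^′ i * [ k ] * (f i * g k)) (ℕP.+-∸-assoc 1 i≤m) ⟩
      q ^′ i * [ suc (m ℕ.∸ i) ] * (f i * g (suc (m ℕ.∸ i)))
        ≈⟨ *-interchange _ _ _ _ ⟩
      q ^′ i * f i * ([ suc (m ℕ.∸ i) ] * g (suc (m ℕ.∸ i)))
        ≈⟨ *-congˡ (D-coeff g (m ℕ.∸ i)) ⟨
      subst-scale q f i * D g (m ℕ.∸ i)
        ∎

    right-last≈0 : right (suc m) ≈ 0#
    right-last≈0 = begin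
      q ^′ suc m * [ m ℕ.∸ m ] * T (suc m)  ≡⟨ cong (λ k → q ^′ suc m * [ k ] * T (suc m)) (ℕP.n∸n≡0 m) ⟩
      q ^′ suc m * 0# * T (suc m)           ≈⟨ *-congʳ (zeroʳ _) ⟩
      0# * T (suc m)                        ≈⟨ zeroˡ _ ⟩
      0#                                    ∎

    right-sum : sumTo (suc (suc m)) right ≈ (subst-scale q f ⋆ D g) m
    right-sum = begin
      sumTo (suc m) right + right (suc m)  ≈⟨ +-congˡ right-last≈0 ⟩
      sumTo (suc m) right + 0#             ≈⟨ +-identityʳ _ ⟩
      sumTo (suc m) right                  ≈⟨ sumTo-cong (suc m) (λ i i<1+m → right≈ i (ℕP.≤-pred i<1+m)) ⟩
      (subst-scale q f ⋆ D g) m            ∎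

  z^-low : ∀ n X k → k ℕ.< n → (z^ n · X) k ≈ 0#
  z^-low n X k k<n with k ℕ.<? n
  ... | yes _   = refl
  ... | no k≮n = contradiction k<n k≮n

  z^-+ : ∀ n X k → (z^ n · X) (n ℕ.+ k) ≈ X k
  z^-+ n X k with n ℕ.+ k ℕ.<? n
  ... | yes n+k<n = contradiction n+k<n (ℕP.m+n≮m n k)
  ... | no _      = reflexive (cong X (ℕP.m+n∸m≡n n k))

  ⋆-order : ∀ h {g} n → (∀ k → k ℕ.< n → g k ≈ 0#) → ∀ j → j ℕ.< n → (h ⋆ g) j ≈ 0#
  ⋆-order h n g≈0 j j<n = sumTo-zero (suc j) λ i _ →
    trans (*-congˡ (g≈0 (j ℕ.∸ i) (ℕP.≤-<-trans (ℕP.m∸n≤m j i) j<n))) (zeroʳ _)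

  ⋆-z^-+ : ∀ h n X t → (h ⋆ (z^ n · X)) (n ℕ.+ t) ≈ (h ⋆ X) t
  ⋆-z^-+ h n X t = begin
    sumTo (suc (n ℕ.+ t)) T  ≈⟨ sumTo-tail-zero T (ℕ.s≤s (ℕP.m≤n+m t n)) beyond ⟩
    sumTo (suc t) T          ≈⟨ sumTo-cong (suc t) (λ i i<1+t → within i (ℕP.≤-pred i<1+t)) ⟩
    (h ⋆ X) t                ∎
    where
    T : ℕ → Carrier
    T i = h i * (z^ n · X) (n ℕ.+ t ℕ.∸ i)

    beyond : ∀ i → suc t ℕ.≤ i → i ℕ.< suc (n ℕ.+ t) → T i ≈ 0#
    beyond i t<i i<1+n+t = trans (*-congˡ (z^-low n X _ n+t-i<n)) (zeroʳ _)
      where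
      n+t-i<n : n ℕ.+ t ℕ.∸ i ℕ.< n
      n+t-i<n = ≡.subst (n ℕ.+ t ℕ.∸ i ℕ.<_) (ℕP.m+n∸n≡m n t)
                        (ℕP.∸-monoʳ-< t<i (ℕP.≤-pred i<1+n+t))

    within : ∀ i → i ℕ.≤ t → T i ≈ h i * X (t ℕ.∸ i)
    within i i≤t = *-congˡ (trans (reflexive (cong (z^ n · X) (ℕP.+-∸-assoc n i≤t)))
                                  (z^-+ n X (t ℕ.∸ i)))

  ⋆-sumSeries : ∀ h Fam → (∀ n k → k ℕ.< n → Fam n k ≈ 0#) → ∀ {j N} → j ℕ.< N →
                (h ⋆ sumSeries Fam) j ≈ sumTo N (λ n → (h ⋆ Fam n) j)
  ⋆-sumSeries h Fam order {j} {N} j<N = begin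
    sumTo (suc j) (λ i → h i * sumSeries Fam (j ℕ.∸ i))
      ≈⟨ sumTo-cong (suc j) (λ i _ → *-congˡ (truncate i)) ⟩
    sumTo (suc j) (λ i → h i * sumTo N (λ n → Fam n (j ℕ.∸ i)))
      ≈⟨ sumTo-cong (suc j) (λ i _ → *-distribˡ-sumTo N _ _) ⟩
    sumTo (suc j) (λ i → sumTo N (λ n → h i * Fam n (j ℕ.∸ i)))
      ≈⟨ sumTo-comm (suc j) N _ ⟩
    sumTo N (λ n → (h ⋆ Fam n) j)
      ∎
    where
    truncate : ∀ i → sumSeries Fam (j ℕ.∸ i) ≈ sumTo N (λ n → Fam n (j ℕ.∸ i))
    truncate i = sym (sumTo-tail-zero _ (ℕP.≤-<-trans (ℕP.m∸n≤m j i) j<N)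
                                      (λ n j-i<n _ → order n (j ℕ.∸ i) j-i<n))

  e⟨_⟩ E⟨_⟩ : Carrier → Series
  e⟨ u ⟩ = subst-scale u e
  E⟨ μ ⟩ = subst-scale μ E

  D-e⟨⟩ : ∀ u → D e⟨ u ⟩ ≋ (u · e⟨ u ⟩)
  D-e⟨⟩ u k = begin
    D e⟨ u ⟩ k                                ≈⟨ D-coeff e⟨ u ⟩ k ⟩
    [ suc k ] * (u * u ^′ k * 1/[ suc k ]!)   ≈⟨ solve 4 (λ S u U I → S :* (u :* U :* I) := u :* (U :* (S :* I)))
                                                       refl [ suc k ] u (u ^′ k) 1/[ suc k ]! ⟩
    u * (u ^′ k * ([ suc k ] * 1/[ suc k ]!)) ≈⟨ *-congˡ (*-congˡ ([1+n]*1/[1+n]!≈1/[n]! k)) ⟩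
    u * e⟨ u ⟩ k                              ∎

  [1+k]C2≡k+kC2 : ∀ k → suc k C 2 ≡ k ℕ.+ k C 2
  [1+k]C2≡k+kC2 k = ≡.trans (≡.sym (nCk+nC[k+1]≡[n+1]C[k+1] k 1)) (cong (ℕ._+ k C 2) (nC1≡n k))

  D-E⟨⟩ : ∀ μ → D E⟨ μ ⟩ ≋ (μ · subst-scale q E⟨ μ ⟩)
  D-E⟨⟩ μ k = begin
    D E⟨ μ ⟩ k
      ≈⟨ D-coeff E⟨ μ ⟩ k ⟩
    [ suc k ] * (μ * μ ^′ k * (q ^′ (suc k C 2) * 1/[ suc k ]!))
      ≈⟨ *-congˡ (*-congˡ (*-congʳ q^[1+k]C2)) ⟩
    [ suc k ] * (μ * μ ^′ k * (q ^′ k * q ^′ (k C 2) * 1/[ suc k ]!))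
      ≈⟨ solve 6 (λ S μ M Q Qc I → S :* (μ :* M :* (Q :* Qc :* I)) := μ :* (Q :* (M :* (Qc :* (S :* I)))))
               refl [ suc k ] μ (μ ^′ k) (q ^′ k) (q ^′ (k C 2)) 1/[ suc k ]! ⟩
    μ * (q ^′ k * (μ ^′ k * (q ^′ (k C 2) * ([ suc k ] * 1/[ suc k ]!))))
      ≈⟨ *-congˡ (*-congˡ (*-congˡ (*-congˡ ([1+n]*1/[1+n]!≈1/[n]! k)))) ⟩
    μ * subst-scale q E⟨ μ ⟩ k
      ∎
    where
    q^[1+k]C2 : q ^′ (suc k C 2) ≈ q ^′ k * q ^′ (k C 2)
    q^[1+k]C2 = trans (reflexive (cong (q ^′_) ([1+k]C2≡k+kC2 k))) (^′-homo-+ q k (k C 2))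

  e⟨⟩⋆E⟨⟩-0 : ∀ u μ → (e⟨ u ⟩ ⋆ E⟨ μ ⟩) 0 ≈ 1#
  e⟨⟩⋆E⟨⟩-0 u μ = begin
    0# + 1# * 1/[ 0 ]! * (1# * (1# * 1/[ 0 ]!))  ≈⟨ +-identityˡ _ ⟩
    1# * 1/[ 0 ]! * (1# * (1# * 1/[ 0 ]!))       ≈⟨ *-cong (*-identityˡ _) (trans (*-identityˡ _) (*-identityˡ _)) ⟩
    1/[ 0 ]! * 1/[ 0 ]!                          ≈⟨ *-cong 1/[0]!≈1 1/[0]!≈1 ⟩
    1# * 1#                                      ≈⟨ *-identityˡ 1# ⟩
    1#                                           ∎

  e⟨⟩⋆E⟨⟩-D : ∀ u μ t → D (e⟨ u ⟩ ⋆ E⟨ μ ⟩) t ≈ (u + μ * q ^′ t) * (e⟨ u ⟩ ⋆ E⟨ μ ⟩) t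
  e⟨⟩⋆E⟨⟩-D u μ t = begin
    D P t
      ≈⟨ D-⋆ e⟨ u ⟩ E⟨ μ ⟩ t ⟩
    (D e⟨ u ⟩ ⋆ E⟨ μ ⟩) t + (subst-scale q e⟨ u ⟩ ⋆ D E⟨ μ ⟩) t
      ≈⟨ +-cong (⋆-congˡ (D-e⟨⟩ u) E⟨ μ ⟩ t) (⋆-congʳ (subst-scale q e⟨ u ⟩) (D-E⟨⟩ μ) t) ⟩
    ((u · e⟨ u ⟩) ⋆ E⟨ μ ⟩) t + (subst-scale q e⟨ u ⟩ ⋆ (μ · subst-scale q E⟨ μ ⟩)) t
      ≈⟨ +-cong (⋆-·ˡ u e⟨ u ⟩ E⟨ μ ⟩ t) (⋆-·ʳ (subst-scale q e⟨ u ⟩) μ (subst-scale q E⟨ μ ⟩) t) ⟩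
    u * P t + μ * (subst-scale q e⟨ u ⟩ ⋆ subst-scale q E⟨ μ ⟩) t
      ≈⟨ +-congˡ (*-congˡ (sym (subst-scale-⋆ q e⟨ u ⟩ E⟨ μ ⟩ t))) ⟩
    u * P t + μ * (q ^′ t * P t)
      ≈⟨ +-congˡ (sym (*-assoc _ _ _)) ⟩
    u * P t + μ * q ^′ t * P t
      ≈⟨ distribʳ _ _ _ ⟨
    (u + μ * q ^′ t) * P t
      ∎
    where
    P : Series
    P = e⟨ u ⟩ ⋆ E⟨ μ ⟩

  e⟨⟩⋆E⟨⟩-annihilated : ∀ u μ A t → u + μ * q ^′ t + [ suc t ] * A ≈ 0# →
    (e⟨ u ⟩ ⋆ E⟨ μ ⟩) (suc t) + A * (e⟨ u ⟩ ⋆ E⟨ μ ⟩) t ≈ 0#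
  e⟨⟩⋆E⟨⟩-annihilated u μ A t scalar≈0 = y*x≈0⇒x≈0 ([suc]≉0 t) (begin
    [ suc t ] * (P (suc t) + A * P t)
      ≈⟨ distribˡ _ _ _ ⟩
    [ suc t ] * P (suc t) + [ suc t ] * (A * P t)
      ≈⟨ +-cong (trans (sym (D-coeff P t)) (e⟨⟩⋆E⟨⟩-D u μ t)) (sym (*-assoc _ _ _)) ⟩
    (u + μ * q ^′ t) * P t + [ suc t ] * A * P t
      ≈⟨ distribʳ _ _ _ ⟨
    (u + μ * q ^′ t + [ suc t ] * A) * P t
      ≈⟨ *-congʳ scalar≈0 ⟩
    0# * P t
      ≈⟨ zeroˡ _ ⟩
    0#
      ∎)
    where
    P : Series
    P = e⟨ u ⟩ ⋆ E⟨ μ ⟩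

  e⟨⟩⋆D-coeff : ∀ {u v} f m → q * u ≈ v →
    (e⟨ v ⟩ ⋆ D f) m ≈ [ suc m ] * (e⟨ u ⟩ ⋆ f) (suc m) - u * (e⟨ u ⟩ ⋆ f) m
  e⟨⟩⋆D-coeff {u} {v} f m qu≈v = begin
    (e⟨ v ⟩ ⋆ D f) m                  ≈⟨ ⋆-congˡ e⟨v⟩≋ (D f) m ⟩
    (subst-scale q e⟨ u ⟩ ⋆ D f) m    ≈⟨ x≈y+z⇒z≈x-y leibniz ⟩
    [ suc m ] * g (suc m) - u * g m   ∎
    where
    g : Series
    g = e⟨ u ⟩ ⋆ f

    e⟨v⟩≋ : e⟨ v ⟩ ≋ subst-scale q e⟨ u ⟩
    e⟨v⟩≋ k = trans (subst-scale-cong e (sym qu≈v) k) (sym (subst-scale-∘ q u e k))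

    leibniz : [ suc m ] * g (suc m) ≈ u * g m + (subst-scale q e⟨ u ⟩ ⋆ D f) m
    leibniz = begin
      [ suc m ] * g (suc m)                                    ≈⟨ D-coeff g m ⟨
      D g m                                                    ≈⟨ D-⋆ e⟨ u ⟩ f m ⟩
      (D e⟨ u ⟩ ⋆ f) m + (subst-scale q e⟨ u ⟩ ⋆ D f) m
        ≈⟨ +-congʳ (trans (⋆-congˡ (D-e⟨⟩ u) f m) (⋆-·ˡ u e⟨ u ⟩ f m)) ⟩
      u * g m + (subst-scale q e⟨ u ⟩ ⋆ D f) m                 ∎

  module Expansion (a b : Carrier) (cs : Series) where

    μ : ℕ → Carrier
    μ n = [ n ] * a + q ^′ n * b

    term : ℕ → Series
    term n = (cs n * 1/[ n ]!) · (z^ n · E⟨ μ n ⟩)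

    u : ℕ → Carrier
    u m = - (μ (suc m) * q⁻¹)

    μ-+ : ∀ s n → μ (s ℕ.+ n) ≈ [ s ] * a + q ^′ s * μ n
    μ-+ s n = begin
      [ s ℕ.+ n ] * a + q ^′ (s ℕ.+ n) * b
        ≈⟨ +-cong (*-congʳ ([m+n]≈[m]+q^m*[n] s n)) (*-congʳ (^′-homo-+ q s n)) ⟩
      ([ s ] + q ^′ s * [ n ]) * a + q ^′ s * q ^′ n * b
        ≈⟨ solve 6 (λ S Qs N a Qn b → (S :+ Qs :* N) :* a :+ Qs :* Qn :* b := S :* a :+ Qs :* (N :* a :+ Qn :* b))
                 refl [ s ] (q ^′ s) [ n ] a (q ^′ n) b ⟩
      [ s ] * a + q ^′ s * μ n
        ∎

    q*u≈-μ : ∀ m → q * u m ≈ - μ (suc m)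
    q*u≈-μ m = begin
      q * - (μ (suc m) * q⁻¹)    ≈⟨ solve 3 (λ q M i → q :* (:- (M :* i)) := :- (q :* i :* M)) refl q (μ (suc m)) q⁻¹ ⟩
      - (q * q⁻¹ * μ (suc m))    ≈⟨ -‿cong (trans (*-congʳ (inverse q q≉0)) (*-identityˡ _)) ⟩
      - μ (suc m)                ∎

    u+μq^t+[1+t]a/q≈0 : ∀ n t → u (n ℕ.+ t) + μ n * q ^′ t + [ suc t ] * (a * q⁻¹) ≈ 0#
    u+μq^t+[1+t]a/q≈0 n t = begin
      - (μ (suc (n ℕ.+ t)) * q⁻¹) + μ n * q ^′ t + [ suc t ] * (a * q⁻¹)
        ≈⟨ +-congʳ (+-congʳ (-‿cong (*-congʳ μ-shift))) ⟩
      - (([ suc t ] * a + q * q ^′ t * μ n) * q⁻¹) + μ n * q ^′ t + [ suc t ] * (a * q⁻¹)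
        ≈⟨ solve 6 (λ S a q Qt M i → :- ((S :* a :+ q :* Qt :* M) :* i) :+ M :* Qt :+ S :* (a :* i)
                                     := Qt :* M :- Qt :* M :* (q :* i))
                 refl [ suc t ] a q (q ^′ t) (μ n) q⁻¹ ⟩
      Z - Z * (q * q⁻¹)
        ≈⟨ +-congˡ (-‿cong (trans (*-congˡ (inverse q q≉0)) (*-identityʳ Z))) ⟩
      Z - Z
        ≈⟨ -‿inverseʳ Z ⟩
      0#
        ∎
      where
      Z : Carrier
      Z = q ^′ t * μ n
      μ-shift : μ (suc (n ℕ.+ t)) ≈ [ suc t ] * a + q * q ^′ t * μ n
      μ-shift = trans (reflexive (cong (λ k → μ (suc k)) (ℕP.+-comm n t))) (μ-+ (suc t) n)

    term-order : ∀ n k → k ℕ.< n → term n k ≈ 0#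
    term-order n k k<n = trans (*-congˡ (z^-low n _ k k<n)) (zeroʳ _)

    ⋆-term-+ : ∀ h n t → (h ⋆ term n) (n ℕ.+ t) ≈ (cs n * 1/[ n ]!) * (h ⋆ E⟨ μ n ⟩) t
    ⋆-term-+ h n t = trans (⋆-·ʳ h (cs n * 1/[ n ]!) (z^ n · E⟨ μ n ⟩) (n ℕ.+ t)) (*-congˡ (⋆-z^-+ h n E⟨ μ n ⟩ t))

    e⋆term-below : ∀ {n m} → n ℕ.≤ m →
      (e⟨ u m ⟩ ⋆ term n) (suc m) + (a * q⁻¹) * (e⟨ u m ⟩ ⋆ term n) m ≈ 0#
    e⋆term-below {n} n≤m with ℕP.m≤n⇒∃[o]m+o≡n n≤m
    ... | t , ≡.refl = begin
      G (suc (n ℕ.+ t)) + A * G (n ℕ.+ t)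
        ≡⟨ cong (λ k → G k + A * G (n ℕ.+ t)) (ℕP.+-suc n t) ⟨
      G (n ℕ.+ suc t) + A * G (n ℕ.+ t)
        ≈⟨ +-cong (⋆-term-+ _ n (suc t)) (*-congˡ (⋆-term-+ _ n t)) ⟩
      cₙ * P (suc t) + A * (cₙ * P t)
        ≈⟨ trans (+-congˡ (x∙yz≈y∙xz A cₙ _)) (sym (distribˡ cₙ _ _)) ⟩
      cₙ * (P (suc t) + A * P t)
        ≈⟨ *-congˡ (e⟨⟩⋆E⟨⟩-annihilated _ (μ n) A t (u+μq^t+[1+t]a/q≈0 n t)) ⟩
      cₙ * 0#
        ≈⟨ zeroʳ cₙ ⟩
      0#
        ∎
      where
      A cₙ : Carrier
      A = a * q⁻¹
      cₙ = cs n * 1/[ n ]!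
      G P : Series
      G = e⟨ u (n ℕ.+ t) ⟩ ⋆ term n
      P = e⟨ u (n ℕ.+ t) ⟩ ⋆ E⟨ μ n ⟩

    e⋆term-top : ∀ m → (e⟨ u m ⟩ ⋆ term (suc m)) (suc m) + (a * q⁻¹) * (e⟨ u m ⟩ ⋆ term (suc m)) m
                       ≈ cs (suc m) * 1/[ suc m ]!
    e⋆term-top m = begin
      G (suc m) + A * G m
        ≡⟨ cong (λ k → G k + A * G m) (ℕP.+-identityʳ (suc m)) ⟨
      G (suc m ℕ.+ 0) + A * G m
        ≈⟨ +-cong (⋆-term-+ e⟨ u m ⟩ (suc m) 0)
                  (*-congˡ (⋆-order e⟨ u m ⟩ (suc m) (term-order (suc m)) m (ℕP.n<1+n m))) ⟩
      cₙ * (e⟨ u m ⟩ ⋆ E⟨ μ (suc m) ⟩) 0 + A * 0#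
        ≈⟨ +-cong (*-congˡ (e⟨⟩⋆E⟨⟩-0 (u m) (μ (suc m)))) (zeroʳ A) ⟩
      cₙ * 1# + 0#
        ≈⟨ trans (+-identityʳ _) (*-identityʳ cₙ) ⟩
      cₙ
        ∎
      where
      A cₙ : Carrier
      A = a * q⁻¹
      cₙ = cs (suc m) * 1/[ suc m ]!
      G : Series
      G = e⟨ u m ⟩ ⋆ term (suc m)

    expansion-coefficient : ∀ {f} → f ≋ sumSeries term → ∀ m →
      (e⟨ u m ⟩ ⋆ f) (suc m) + (a * q⁻¹) * (e⟨ u m ⟩ ⋆ f) m ≈ cs (suc m) * 1/[ suc m ]!
    expansion-coefficient {f} f≋ m = begin
      (e⟨ u m ⟩ ⋆ f) (suc m) + A * (e⟨ u m ⟩ ⋆ f) m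
        ≈⟨ +-cong (coeff (ℕP.n<1+n (suc m))) (*-congˡ (coeff (ℕP.m<n⇒m<1+n (ℕP.n<1+n m)))) ⟩
      sumTo N (λ n → G n (suc m)) + A * sumTo N (λ n → G n m)
        ≈⟨ +-congˡ (*-distribˡ-sumTo N A _) ⟩
      sumTo N (λ n → G n (suc m)) + sumTo N (λ n → A * G n m)
        ≈⟨ sumTo-+ N _ _ ⟨
      sumTo (suc m) W + W (suc m)
        ≈⟨ +-cong (sumTo-zero (suc m) λ n n<1+m → e⋆term-below (ℕP.≤-pred n<1+m)) (e⋆term-top m) ⟩
      0# + cs (suc m) * 1/[ suc m ]!
        ≈⟨ +-identityˡ _ ⟩
      cs (suc m) * 1/[ suc m ]!
        ∎
      where
      N : ℕ
      N = suc (suc m)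
      A : Carrier
      A = a * q⁻¹
      G : ℕ → Series
      G n = e⟨ u m ⟩ ⋆ term n
      W : ℕ → Carrier
      W n = G n (suc m) + A * G n m
      coeff : ∀ {j} → j ℕ.< N → (e⟨ u m ⟩ ⋆ f) j ≈ sumTo N (λ n → G n j)
      coeff {j} j<N = trans (⋆-congʳ e⟨ u m ⟩ f≋ j) (⋆-sumSeries e⟨ u m ⟩ term term-order j<N)

    factorial-combination : ∀ m G₀ G₁ →
      [ m ]! * ([ suc m ] * G₁ - u m * G₀) - q ^′ m * b * ([ m ]! * G₀)
      ≈ [ suc m ]! * (G₁ + (a * q⁻¹) * G₀)
    factorial-combination m G₀ G₁ = begin
      [ m ]! * ([ suc m ] * G₁ - u m * G₀) - q ^′ m * b * ([ m ]! * G₀)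
        ≈⟨ solve 9 (λ Fm S G₁ G₀ a i q Qm b →
                      Fm :* (S :* G₁ :- :- ((S :* a :+ q :* Qm :* b) :* i) :* G₀) :- Qm :* b :* (Fm :* G₀)
                      := S :* Fm :* (G₁ :+ a :* i :* G₀) :+ Fm :* G₀ :* Qm :* b :* (q :* i) :- Fm :* G₀ :* Qm :* b)
                 refl [ m ]! [ suc m ] G₁ G₀ a q⁻¹ q (q ^′ m) b ⟩
      X + Y * (q * q⁻¹) - Y
        ≈⟨ +-congʳ (+-congˡ (trans (*-congˡ (inverse q q≉0)) (*-identityʳ Y))) ⟩
      X + Y - Y
        ≈⟨ solve 2 (λ X Y → X :+ Y :- Y := X) refl X Y ⟩
      X
        ∎
      where
      X Y : Carrier
      X = [ suc m ]! * (G₁ + (a * q⁻¹) * G₀)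
      Y = [ m ]! * G₀ * q ^′ m * b

mainTheorem10 : ∀ {c ℓ : Level} (F : Field c ℓ) →
    let open Field F hiding (zero) in
    let open FieldNotions F in
    CharZero →
    (q a b : Carrier) → (q≉0 : ¬ (q ≈ 0#)) → (notRoot : NotRootOfUnity q) →
    let open QCalculus F q q≉0 notRoot in
    (f cs : Series) →
    f ≋ sumSeries (λ n → (cs n * 1/[ n ]!) · (z^ n · subst-scale ([ n ] * a + q ^′ n * b) E)) →
    ∀ (m : ℕ) →
    let λn = [ suc m ] * a + q ^′ suc m * b in
    cs (suc m) ≈ L (D^ m (subst-scale (- λn) e ⋆ D f))
    -′ q ^′ m * b * L (D^ m (subst-scale (- (λn * q⁻¹)) e ⋆ f))
mainTheorem10 F _ q a b q≉0 notRoot f cs f≋ m = begin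
  cs (suc m)
    ≈⟨ x≈y*[x*y⁻¹] _ _ [ suc m ]!≉0 ⟩
  [ suc m ]! * (cs (suc m) * 1/[ suc m ]!)
    ≈⟨ *-congˡ (expansion-coefficient f≋ m) ⟨
  [ suc m ]! * (g (suc m) + (a * q⁻¹) * g m)
    ≈⟨ factorial-combination m (g m) (g (suc m)) ⟨
  [ m ]! * ([ suc m ] * g (suc m) - u m * g m) - q ^′ m * b * ([ m ]! * g m)
    ≈⟨ +-cong (*-congˡ (e⟨⟩⋆D-coeff f m (q*u≈-μ m))) (-‿cong (*-congˡ (L-D^ m g))) ⟨
  [ m ]! * (e⟨ - μ (suc m) ⟩ ⋆ D f) m - q ^′ m * b * L (D^ m g)
    ≈⟨ +-congʳ (L-D^ m _) ⟨
  L (D^ m (e⟨ - μ (suc m) ⟩ ⋆ D f)) - q ^′ m * b * L (D^ m g)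
    ∎
  where
  open Field F hiding (zero)
  open FieldNotions F
  open QCalculus F q q≉0 notRoot
  open QSeriesProperties F q q≉0 notRoot
  open Expansion a b cs
  open ≈-Reasoning setoid
  g : Series
  g = e⟨ u m ⟩ ⋆ f
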